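{- Let $p\geq 1$, let $t\in\{4p-1,4p\}$, let $s=t+1$, and for $i\in\mathbb{Z}$ let $B_i=\{is,\ldots,(i+1)s-1\}$. Let $f:\mathbb{Z}\to\mathbb{Z}_{>0}$ be a packing coloring of $D(1,t)$ such that for every color $c$ used by $f$: $c<t$, and whenever two distinct blocks $B_i,B_j$ both contain a vertex of color $c$, then $|i-j|>\frac{c}{2}$ and $\{x\in\{0,\ldots,s-1\}: f(is+x)=c\}=\{x\in\{0,\ldots,s-1\}: f(js+x)=c\}$. Then $f$ is also a packing coloring of $D(1,t+2)$.
   Context: $D(1,t)$ denotes the distance graph $G(\mathbb{Z},\{1,t\})$: vertex set $\mathbb{Z}$, two distinct integers adjacent iff their difference in absolute value is $1$ or $t$. A packing coloring of a graph $G$ is a map $f:V(G)\to\mathbb{Z}_{>0}$ such that any two distinct vertices $u,v$ with $f(u)=f(v)=c$ satisfy $d_G(u,v)\geq c+1$. -}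

module Defs where

open import Data.Nat using (ℕ; zero; suc; _≤_; _<_)
open import Data.Integer using (ℤ; _-_; ∣_∣)
open import Data.Product using (_×_)
open import Data.Sum using (_⊎_)
open import Relation.Nullary using (¬_)
open import Relation.Binary.PropositionalEquality using (_≡_; _≢_)

Adj : ℕ → ℤ → ℤ → Set
Adj t u v = u ≢ v × (∣ u - v ∣ ≡ 1 ⊎ ∣ u - v ∣ ≡ t)

data Walk (t : ℕ) : ℤ → ℤ → ℕ → Set where
  nil  : ∀ {u} → Walk t u u zero
  step : ∀ {u w v n} → Adj t u w → Walk t w v n → Walk t u v (suc n)

DistGE : ℕ → ℤ → ℤ → ℕ → Set
DistGE t u v k = ∀ n → n < k → ¬ Walk t u v n

-- Packing coloring of D(1,t) with colors in ℤ_{>0} (represented as ℕ with f x ≥ 1).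
IsPackingColoring : ℕ → (ℤ → ℕ) → Set
IsPackingColoring t f =
  (∀ x → 1 ≤ f x) ×
  (∀ u v → u ≢ v → f u ≡ f v → DistGE t u v (suc (f u)))

module Submission where

-- Write s = t + 1 and cut ℤ into the blocks B_i = {i s, …, i s + t}.
-- Suppose u ≠ v carry the same colour c and are joined by a walk of length ≤ c in
-- D(1,t+2).  Such a walk moves by a + b (s + 1) with |a| + |b| ≤ c.  Put
-- u = i s + x and v = j s + y.  Blocks carrying c share their c-positions, so
-- f(i s + y) = c as well.
--   * If x ≠ y, the vertices i s + x and i s + y are at line distance |y - x| ≤ t,
--     so packing in D(1,t) gives c < |y - x| and c + |y - x| ≤ t.
--   * If x = y, then i ≠ j and the hypothesis gives c < 2 |j - i|.
-- From a + b (s + 1) = (j - i) s + (y - x) we get a + b - (y - x) = (j - i - b) s,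
-- whose left side is smaller than s in absolute value; hence b = j - i and
-- a + b = y - x, and both cases contradict |a| + |b| ≤ c.

open import Defs
open import Data.Nat using (ℕ; suc; _+_; _≤_; _<_; _*_; _∸_)
open import Data.Integer using (ℤ; +_; ∣_∣) renaming (_*_ to _*ℤ_; _+_ to _+ℤ_; _-_ to _-ℤ_)
open import Data.Product using (_×_; ∃)
open import Data.Sum using (_⊎_)
open import Function.Bundles using (_⇔_)
open import Relation.Binary.PropositionalEquality using (_≡_; _≢_)
open import Data.Nat using (zero; z≤n; s≤s; _≤?_; _≟_)
import Data.Nat.Properties as ℕP
open import Data.Integer using (-_; 0ℤ; 1ℤ; -1ℤ; -[1+_]; +[1+_])
import Data.Integer as ℤ
import Data.Integer.Properties as ℤP
open import Data.Integer.DivMod using (_/ℕ_; _%ℕ_; a≡a%ℕn+[a/ℕn]*n; n%ℕd<d)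
open import Data.Integer.Tactic.RingSolver using (solve-∀)
open import Data.Product using (_,_; ∃₂; proj₁; proj₂)
open import Data.Sum using (inj₁; inj₂)
import Data.Sum as Sum
open import Data.Empty using (⊥; ⊥-elim)
open import Relation.Nullary using (yes; no)
open import Relation.Binary.PropositionalEquality using (refl; sym; trans; cong; subst; module ≡-Reasoning)
open import Function.Bundles using (module Equivalence)

Packing : ℕ → (ℤ → ℕ) → Set
Packing t f = ∀ u v → u ≢ v → f u ≡ f v → DistGE t u v (suc (f u))

shift-gap : ∀ u k → ∣ u -ℤ (u +ℤ + k) ∣ ≡ k
shift-gap u k = trans (cong ∣_∣ (regroup u (+ k))) (ℤP.∣-i∣≡∣i∣ (+ k))
  where
  regroup : ∀ u d → u -ℤ (u +ℤ d) ≡ - d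
  regroup = solve-∀

shift-distinct : ∀ u k → 1 ≤ k → u ≢ u +ℤ + k
shift-distinct u k 1≤k u≡u+k = ℕP.<⇒≢ 1≤k (begin
  0                     ≡⟨ cong ∣_∣ (ℤP.+-inverseʳ u) ⟨
  ∣ u -ℤ u ∣            ≡⟨ cong (λ w → ∣ u -ℤ w ∣) u≡u+k ⟩
  ∣ u -ℤ (u +ℤ + k) ∣   ≡⟨ shift-gap u k ⟩
  k                     ∎)
  where open ≡-Reasoning

shift-adjacent : ∀ m u k → 1 ≤ k → (k ≡ 1 ⊎ k ≡ m) → Adj m u (u +ℤ + k)
shift-adjacent m u k 1≤k k∈ =
  shift-distinct u k 1≤k , Sum.map (trans (shift-gap u k)) (trans (shift-gap u k)) k∈

adjacent-sym : ∀ {m u v} → Adj m u v → Adj m v u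
adjacent-sym {u = u} {v} (u≢v , gap) =
  (λ v≡u → u≢v (sym v≡u)) , subst (λ d → d ≡ 1 ⊎ d ≡ _) (ℤP.∣i-j∣≡∣j-i∣ u v) gap

rightward : ∀ m u n → Walk m u (u +ℤ + n) n
rightward m u zero    = subst (λ w → Walk m u w 0) (sym (ℤP.+-identityʳ u)) nil
rightward m u (suc n) = step (shift-adjacent m u 1 (s≤s z≤n) (inj₁ refl))
  (subst (λ w → Walk m (u +ℤ 1ℤ) w n) (ℤP.+-assoc u 1ℤ (+ n)) (rightward m (u +ℤ 1ℤ) n))

leftward : ∀ m u n → Walk m (u +ℤ + n) u n
leftward m u zero    = subst (λ w → Walk m w u 0) (sym (ℤP.+-identityʳ u)) nil
leftward m u (suc n) = subst (λ w → Walk m w u (suc n)) one-more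
  (step (adjacent-sym (shift-adjacent m (u +ℤ + n) 1 (s≤s z≤n) (inj₁ refl))) (leftward m u n))
  where
  one-more : (u +ℤ + n) +ℤ 1ℤ ≡ u +ℤ + suc n
  one-more = trans (ℤP.+-assoc u (+ n) 1ℤ) (cong (λ k → u +ℤ + k) (ℕP.+-comm n 1))

walk-length-bound : ∀ {m u v k n} → DistGE m u v k → Walk m u v n → k ≤ n
walk-length-bound {k = k} {n} far W with k ≤? n
... | yes k≤n = k≤n
... | no  k≰n = ⊥-elim (far n (ℕP.≰⇒> k≰n) W)

unit-multiple : ∀ z → ∃ λ δ → ∣ δ ∣ ≡ 1 × z ≡ δ *ℤ + ∣ z ∣
unit-multiple (+ n)    = 1ℤ , refl , sym (ℤP.*-identityˡ (+ n))
unit-multiple -[1+ n ] = -1ℤ , refl , sym (ℤP.-1*i≡-i (+ suc n))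

adjacent-offset : ∀ {m u w} → Adj m u w →
  ∃ λ δ → ∣ δ ∣ ≡ 1 × (w ≡ u +ℤ δ ⊎ w ≡ u +ℤ δ *ℤ + m)
adjacent-offset {m} {u} {w} (_ , gap) with unit-multiple (w -ℤ u)
... | δ , ∣δ∣≡1 , w-u≡ = δ , ∣δ∣≡1 , Sum.map by-one by-m gap
  where
  w≡ : ∀ k → ∣ u -ℤ w ∣ ≡ k → w ≡ u +ℤ δ *ℤ + k
  w≡ k g = begin
    w                             ≡⟨ recombine u w ⟩
    u +ℤ (w -ℤ u)                 ≡⟨ cong (u +ℤ_) w-u≡ ⟩
    u +ℤ δ *ℤ + ∣ w -ℤ u ∣        ≡⟨ cong (λ d → u +ℤ δ *ℤ + d) (trans (ℤP.∣i-j∣≡∣j-i∣ w u) g) ⟩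
    u +ℤ δ *ℤ + k                 ∎
    where
    open ≡-Reasoning
    recombine : ∀ u w → w ≡ u +ℤ (w -ℤ u)
    recombine = solve-∀
  by-one : ∣ u -ℤ w ∣ ≡ 1 → w ≡ u +ℤ δ
  by-one g = trans (w≡ 1 g) (cong (u +ℤ_) (ℤP.*-identityʳ δ))
  by-m : ∣ u -ℤ w ∣ ≡ m → w ≡ u +ℤ δ *ℤ + m
  by-m = w≡ m

unit-step : ∀ δ a → ∣ δ ∣ ≡ 1 → ∣ δ +ℤ a ∣ ≤ suc ∣ a ∣
unit-step δ a ∣δ∣≡1 = subst (λ k → ∣ δ +ℤ a ∣ ≤ k + ∣ a ∣) ∣δ∣≡1 (ℤP.∣i+j∣≤∣i∣+∣j∣ δ a)

walk-displacement : ∀ {m u v n} → Walk m u v n →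
  ∃₂ λ a b → v ≡ u +ℤ a +ℤ b *ℤ + m × ∣ a ∣ + ∣ b ∣ ≤ n
walk-displacement {m} {u} nil = 0ℤ , 0ℤ , sym (stay u (+ m)) , z≤n
  where
  stay : ∀ u m → u +ℤ 0ℤ +ℤ 0ℤ *ℤ m ≡ u
  stay = solve-∀
walk-displacement {m} {u} {n = suc n} (step adj W) with adjacent-offset adj | walk-displacement W
... | δ , ∣δ∣≡1 , inj₁ refl | a , b , refl , short =
  δ +ℤ a , b , regroup u δ a b (+ m) ,
  ℕP.≤-trans (ℕP.+-monoˡ-≤ ∣ b ∣ (unit-step δ a ∣δ∣≡1)) (s≤s short)
  where
  regroup : ∀ u δ a b m → u +ℤ δ +ℤ a +ℤ b *ℤ m ≡ u +ℤ (δ +ℤ a) +ℤ b *ℤ m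
  regroup = solve-∀
... | δ , ∣δ∣≡1 , inj₂ refl | a , b , refl , short =
  a , δ +ℤ b , regroup u δ a b (+ m) ,
  ℕP.≤-trans (ℕP.+-monoʳ-≤ ∣ a ∣ (unit-step δ b ∣δ∣≡1))
    (subst (_≤ suc n) (sym (ℕP.+-suc ∣ a ∣ ∣ b ∣)) (s≤s short))
  where
  regroup : ∀ u δ a b m → u +ℤ δ *ℤ m +ℤ a +ℤ b *ℤ m ≡ u +ℤ a +ℤ (δ +ℤ b) *ℤ m
  regroup = solve-∀

-- Two vertices of the same colour c at line distance d ≤ t in a packing colouring of
-- D(1,t): the unit walk (length d) and the walk "jump by t, step back t - d" (length
-- 1 + t - d) both have length > c.
close-pair : ∀ {t f} → Packing t f → ∀ z d → 1 ≤ d → d ≤ t → f z ≡ f (z +ℤ + d) →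
  f z < d × f z + d ≤ t
close-pair {t} {f} packing z d 1≤d d≤t same =
  walk-length-bound far (rightward t z d) ,
  ℕP.m≤o∸n⇒m+n≤o (f z) d≤t (ℕP.≤-pred (walk-length-bound far jump-back))
  where
  far : DistGE t z (z +ℤ + d) (suc (f z))
  far = packing z (z +ℤ + d) (shift-distinct z d 1≤d) same
  lands : (z +ℤ + d) +ℤ + (t ∸ d) ≡ z +ℤ + t
  lands = trans (ℤP.+-assoc z (+ d) (+ (t ∸ d))) (cong (λ k → z +ℤ + k) (ℕP.m+[n∸m]≡n d≤t))
  jump-back : Walk t z (z +ℤ + d) (suc (t ∸ d))
  jump-back = step (shift-adjacent t z t (ℕP.≤-trans 1≤d d≤t) (inj₂ refl))
    (subst (λ w → Walk t w (z +ℤ + d) (t ∸ d)) lands (leftward t (z +ℤ + d) (t ∸ d)))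

near-pair : ∀ {t f} → Packing t f → ∀ z e → e ≢ 0ℤ → ∣ e ∣ ≤ t → f z ≡ f (z +ℤ e) →
  f z < ∣ e ∣ × f z + ∣ e ∣ ≤ t
near-pair packing z (+ zero)  e≢0 _ _ = ⊥-elim (e≢0 refl)
near-pair packing z +[1+ n ] _ e≤t same = close-pair packing z (suc n) (s≤s z≤n) e≤t same
near-pair {t} {f} packing z -[1+ n ] _ e≤t same =
  subst (λ c → c < suc n × c + suc n ≤ t) (sym same)
    (close-pair packing z′ (suc n) (s≤s z≤n) e≤t (trans (sym same) (cong f (back z -[1+ n ]))))
  where
  z′ : ℤ
  z′ = z +ℤ -[1+ n ]
  back : ∀ z e → z ≡ (z +ℤ e) -ℤ e
  back = solve-∀

small-multiple-is-zero : ∀ r s → ∣ r *ℤ s ∣ < ∣ s ∣ → r ≡ 0ℤ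
small-multiple-is-zero (+ zero)  s _ = refl
small-multiple-is-zero +[1+ n ] s small =
  ⊥-elim (ℕP.<⇒≱ small (subst (∣ s ∣ ≤_) (sym (ℤP.abs-* +[1+ n ] s)) (ℕP.m≤m+n ∣ s ∣ _)))
small-multiple-is-zero -[1+ n ] s small =
  ⊥-elim (ℕP.<⇒≱ small (subst (∣ s ∣ ≤_) (sym (ℤP.abs-* -[1+ n ] s)) (ℕP.m≤m+n ∣ s ∣ _)))

collapse : ∀ a b K e s → a +ℤ b *ℤ (s +ℤ 1ℤ) ≡ K *ℤ s +ℤ e →
  ∣ a ∣ + ∣ b ∣ + ∣ e ∣ < ∣ s ∣ → b ≡ K × a +ℤ b ≡ e
collapse a b K e s eq small =
  sym (ℤP.i-j≡0⇒i≡j K b K-b≡0) ,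
  ℤP.i-j≡0⇒i≡j (a +ℤ b) e (trans regroup (trans (cong (_*ℤ s) K-b≡0) (ℤP.*-zeroˡ s)))
  where
  open ≡-Reasoning
  split : ∀ a b e s → a +ℤ b -ℤ e ≡ a +ℤ b *ℤ (s +ℤ 1ℤ) -ℤ b *ℤ s -ℤ e
  split = solve-∀
  cancel : ∀ b K e s → K *ℤ s +ℤ e -ℤ b *ℤ s -ℤ e ≡ (K -ℤ b) *ℤ s
  cancel = solve-∀
  regroup : a +ℤ b -ℤ e ≡ (K -ℤ b) *ℤ s
  regroup = begin
    a +ℤ b -ℤ e                          ≡⟨ split a b e s ⟩
    a +ℤ b *ℤ (s +ℤ 1ℤ) -ℤ b *ℤ s -ℤ e   ≡⟨ cong (λ w → w -ℤ b *ℤ s -ℤ e) eq ⟩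
    K *ℤ s +ℤ e -ℤ b *ℤ s -ℤ e           ≡⟨ cancel b K e s ⟩
    (K -ℤ b) *ℤ s                        ∎
  bound : ∣ a +ℤ b -ℤ e ∣ ≤ ∣ a ∣ + ∣ b ∣ + ∣ e ∣
  bound = ℕP.≤-trans (ℤP.∣i-j∣≤∣i∣+∣j∣ (a +ℤ b) e) (ℕP.+-monoˡ-≤ ∣ e ∣ (ℤP.∣i+j∣≤∣i∣+∣j∣ a b))
  K-b≡0 : K -ℤ b ≡ 0ℤ
  K-b≡0 = small-multiple-is-zero (K -ℤ b) s
    (ℕP.≤-<-trans (subst (λ w → ∣ w ∣ ≤ _) regroup bound) small)

-- An offset e with c < |e| and c + |e| < |s| cannot be reached, modulo multiples
-- of s, by a + b(s + 1) with |a| + |b| ≤ c: the collapse forces |e| = |a + b| ≤ c.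
offset-unreachable : ∀ a b K e s c → a +ℤ b *ℤ (s +ℤ 1ℤ) ≡ K *ℤ s +ℤ e →
  ∣ a ∣ + ∣ b ∣ ≤ c → c < ∣ e ∣ → c + ∣ e ∣ < ∣ s ∣ → ⊥
offset-unreachable a b K e s c eq short c<e room with
  collapse a b K e s eq (ℕP.≤-<-trans (ℕP.+-monoˡ-≤ ∣ e ∣ short) room)
... | _ , a+b≡e = ℕP.<⇒≱ c<e
  (ℕP.≤-trans (subst (λ w → ∣ w ∣ ≤ _) a+b≡e (ℤP.∣i+j∣≤∣i∣+∣j∣ a b)) short)

-- With offset 0, a multiple K s with c < 2|K| cannot be reached by a + b(s + 1)
-- with |a| + |b| ≤ c < |s|: the collapse forces a = -K and b = K.
aligned-unreachable : ∀ a b K s c → a +ℤ b *ℤ (s +ℤ 1ℤ) ≡ K *ℤ s +ℤ 0ℤ →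
  ∣ a ∣ + ∣ b ∣ ≤ c → c < ∣ s ∣ → c < 2 * ∣ K ∣ → ⊥
aligned-unreachable a b K s c eq short c<s c<2K with
  collapse a b K 0ℤ s eq (subst (_< ∣ s ∣) (sym (ℕP.+-identityʳ _)) (ℕP.≤-<-trans short c<s))
... | refl , a+b≡0 = ℕP.<⇒≱ c<2K (subst (_≤ c) opposite short)
  where
  open ≡-Reasoning
  isolate : ∀ a b → a ≡ (a +ℤ b) -ℤ b
  isolate = solve-∀
  a≡-b : a ≡ - b
  a≡-b = trans (isolate a b) (trans (cong (_-ℤ b) a+b≡0) (ℤP.+-identityˡ (- b)))
  opposite : ∣ a ∣ + ∣ b ∣ ≡ 2 * ∣ b ∣
  opposite = begin
    ∣ a ∣ + ∣ b ∣         ≡⟨ cong (λ w → ∣ w ∣ + ∣ b ∣) a≡-b ⟩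
    ∣ - b ∣ + ∣ b ∣       ≡⟨ cong (_+ ∣ b ∣) (ℤP.∣-i∣≡∣i∣ b) ⟩
    ∣ b ∣ + ∣ b ∣         ≡⟨ cong (λ k → ∣ b ∣ + k) (ℕP.+-identityʳ ∣ b ∣) ⟨
    2 * ∣ b ∣             ∎

block-vertex : ℕ → ℤ → ℕ → ℤ
block-vertex t i x = (i *ℤ + suc t) +ℤ + x

BlockSeparated : ℕ → (ℤ → ℕ) → Set
BlockSeparated t f = ∀ (c : ℕ) (i j : ℤ) → i ≢ j →
  ∃ (λ x → x < suc t × f (block-vertex t i x) ≡ c) →
  ∃ (λ y → y < suc t × f (block-vertex t j y) ≡ c) →
  (c < 2 * ∣ i -ℤ j ∣) ×
  (∀ x → x < suc t → (f (block-vertex t i x) ≡ c) ⇔ (f (block-vertex t j x) ≡ c))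

block-coordinates : ∀ t z → ∃₂ λ i x → x < suc t × z ≡ block-vertex t i x
block-coordinates t z = z /ℕ suc t , z %ℕ suc t , n%ℕd<d z (suc t) ,
  trans (a≡a%ℕn+[a/ℕn]*n z (suc t)) (ℤP.+-comm (+ (z %ℕ suc t)) ((z /ℕ suc t) *ℤ + suc t))

position-gap : ∀ t x y → x < suc t → y < suc t → ∣ + y -ℤ + x ∣ ≤ t
position-gap t x y x<s y<s = subst (_≤ t) (cong ∣_∣ (sym (ℤP.m-n≡m⊖n y x)))
  (ℕP.≤-trans (ℤP.∣m⊝n∣≤m⊔n y x) (ℕP.⊔-lub (ℕP.≤-pred y<s) (ℕP.≤-pred x<s)))

within-block : ∀ t i x y → block-vertex t i x +ℤ (+ y -ℤ + x) ≡ block-vertex t i y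
within-block t i x y = regroup (i *ℤ + suc t) (+ x) (+ y)
  where
  regroup : ∀ w x y → w +ℤ x +ℤ (y -ℤ x) ≡ w +ℤ y
  regroup = solve-∀

pattern-transfer : ∀ {t f} → BlockSeparated t f → ∀ {c i j x y} → x < suc t → y < suc t →
  f (block-vertex t i x) ≡ c → f (block-vertex t j y) ≡ c → f (block-vertex t i y) ≡ c
pattern-transfer separated {c} {i} {j} x<s y<s at-x at-y with i ℤ.≟ j
... | yes refl = at-y
... | no  i≢j  =
  Equivalence.from (proj₂ (separated c i j i≢j (_ , x<s , at-x) (_ , y<s , at-y)) _ y<s) at-y

aligned-separation : ∀ {t f} → BlockSeparated t f → ∀ {c i j x} → i ≢ j → x < suc t →
  f (block-vertex t i x) ≡ c → f (block-vertex t j x) ≡ c → c < 2 * ∣ j -ℤ i ∣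
aligned-separation separated {c} {i} {j} i≢j x<s at-i at-j =
  subst (λ k → c < 2 * k) (ℤP.∣i-j∣≡∣j-i∣ i j)
    (proj₁ (separated c i j i≢j (_ , x<s , at-i) (_ , x<s , at-j)))

block-displacement : ∀ t i j x y a b →
  block-vertex t j y ≡ block-vertex t i x +ℤ a +ℤ b *ℤ + (t + 2) →
  a +ℤ b *ℤ (+ suc t +ℤ 1ℤ) ≡ (j -ℤ i) *ℤ + suc t +ℤ (+ y -ℤ + x)
block-displacement t i j x y a b moved = begin
  a +ℤ b *ℤ (s +ℤ 1ℤ)                             ≡⟨ isolate (i *ℤ s +ℤ + x) a b s ⟩
  (i *ℤ s +ℤ + x) +ℤ a +ℤ b *ℤ (s +ℤ 1ℤ) -ℤ (i *ℤ s +ℤ + x)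
    ≡⟨ cong (λ m → (i *ℤ s +ℤ + x) +ℤ a +ℤ b *ℤ m -ℤ (i *ℤ s +ℤ + x)) (cong +_ (ℕP.+-suc t 1)) ⟨
  (i *ℤ s +ℤ + x) +ℤ a +ℤ b *ℤ + (t + 2) -ℤ (i *ℤ s +ℤ + x)
    ≡⟨ cong (_-ℤ (i *ℤ s +ℤ + x)) moved ⟨
  (j *ℤ s +ℤ + y) -ℤ (i *ℤ s +ℤ + x)              ≡⟨ difference i j (+ x) (+ y) s ⟩
  (j -ℤ i) *ℤ s +ℤ (+ y -ℤ + x)                   ∎
  where
  open ≡-Reasoning
  s = + suc t
  isolate : ∀ w a b s → a +ℤ b *ℤ (s +ℤ 1ℤ) ≡ w +ℤ a +ℤ b *ℤ (s +ℤ 1ℤ) -ℤ w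
  isolate = solve-∀
  difference : ∀ i j x y s → (j *ℤ s +ℤ y) -ℤ (i *ℤ s +ℤ x) ≡ (j -ℤ i) *ℤ s +ℤ (y -ℤ x)
  difference = solve-∀

different-positions-apart : ∀ {t f} → Packing t f → ∀ {c i x y} → x < suc t → y < suc t →
  x ≢ y → f (block-vertex t i x) ≡ c → f (block-vertex t i y) ≡ c →
  ∀ a b K → a +ℤ b *ℤ (+ suc t +ℤ 1ℤ) ≡ K *ℤ + suc t +ℤ (+ y -ℤ + x) →
  ∣ a ∣ + ∣ b ∣ ≤ c → ⊥
different-positions-apart {t} {f} packing {c} {i} {x} {y} x<s y<s x≢y at-x at-y a b K eq short =
  offset-unreachable a b K e (+ suc t) c eq short
    (subst (_< ∣ e ∣) at-x (proj₁ close)) (s≤s (subst (λ k → k + ∣ e ∣ ≤ t) at-x (proj₂ close)))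
  where
  e : ℤ
  e = + y -ℤ + x
  e≢0 : e ≢ 0ℤ
  e≢0 e≡0 = x≢y (sym (ℤP.+-injective (ℤP.i-j≡0⇒i≡j (+ y) (+ x) e≡0)))
  close : f (block-vertex t i x) < ∣ e ∣ × f (block-vertex t i x) + ∣ e ∣ ≤ t
  close = near-pair packing (block-vertex t i x) e e≢0 (position-gap t x y x<s y<s)
    (trans at-x (sym (trans (cong f (within-block t i x y)) at-y)))

same-position-apart : ∀ {t f} → BlockSeparated t f → ∀ {c i j x} → i ≢ j → x < suc t →
  f (block-vertex t i x) ≡ c → f (block-vertex t j x) ≡ c → c < suc t →
  ∀ a b → a +ℤ b *ℤ (+ suc t +ℤ 1ℤ) ≡ (j -ℤ i) *ℤ + suc t +ℤ (+ x -ℤ + x) →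
  ∣ a ∣ + ∣ b ∣ ≤ c → ⊥
same-position-apart {t} {f} separated {c} {i} {j} {x} i≢j x<s at-i at-j c<s a b eq short =
  aligned-unreachable a b (j -ℤ i) (+ suc t) c
    (trans eq (cong ((j -ℤ i) *ℤ + suc t +ℤ_) (ℤP.+-inverseʳ (+ x))))
    short c<s (aligned-separation {t} {f} separated {c} {i} {j} i≢j x<s at-i at-j)

packed-at-distance-t+2 : ∀ {t f} → Packing t f → (∀ z → f z < t) → BlockSeparated t f →
  Packing (t + 2) f
packed-at-distance-t+2 {t} {f} packing below-t separated u v u≢v same n n<c+1 walk
  with block-coordinates t u | block-coordinates t v | walk-displacement walk
... | i , x , x<s , refl | j , y , y<s , refl | a , b , moved , short-walk with x ≟ y
...   | no x≢y   = different-positions-apart packing {i = i} x<s y<s x≢y refl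
                     (pattern-transfer {t} {f} separated {i = i} {j} x<s y<s refl (sym same))
                     a b (j -ℤ i) (block-displacement t i j x y a b moved)
                     (ℕP.≤-trans short-walk (ℕP.≤-pred n<c+1))
...   | yes refl = same-position-apart {t} {f} separated {i = i} {j} i≢j x<s refl (sym same)
                     (ℕP.m<n⇒m<1+n (below-t u)) a b (block-displacement t i j x x a b moved)
                     (ℕP.≤-trans short-walk (ℕP.≤-pred n<c+1))
  where
  i≢j : i ≢ j
  i≢j i≡j = u≢v (cong (λ k → block-vertex t k x) i≡j)

lemma3 : (p t : ℕ) → 1 ≤ p → (t ≡ 4 * p ∸ 1 ⊎ t ≡ 4 * p) →
    (f : ℤ → ℕ) → IsPackingColoring t f →
    (∀ x → f x < t) →
    (∀ (c : ℕ) (i j : ℤ) → i ≢ j →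
      ∃ (λ x → x < suc t × f ((i *ℤ + suc t) +ℤ + x) ≡ c) →
      ∃ (λ y → y < suc t × f ((j *ℤ + suc t) +ℤ + y) ≡ c) →
      (c < 2 * ∣ i -ℤ j ∣) ×
      (∀ x → x < suc t →
        (f ((i *ℤ + suc t) +ℤ + x) ≡ c) ⇔ (f ((j *ℤ + suc t) +ℤ + x) ≡ c))) →
    IsPackingColoring (t + 2) f
lemma3 _ t _ _ f (positive , packing) below-t separated =
  positive , packed-at-distance-t+2 packing below-t separated
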